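{- Let $Q$ be a generalized quantifier of type $\langle n\rangle$ and consider mt-logic extended by $Q$. Let $\varphi$ be an untangled formula of $\mathrm{FO}(Q)$ and $X$ a team with $\mathrm{FV}(\varphi)\subseteq\mathrm{dom}(X)$ and $\mathrm{dom}(X)\cap\mathrm{BV}(\varphi)=\emptyset$. Then $\mathcal M,X\models\varphi$ iff $X=[\![\varphi]\!]^{\mathcal M}_{\mathrm{dom}(X)}$.
   Context: $\mathcal M$ is a structure with universe $M$. Assignments are functions $s:V\to M$ with $V$ a finite set of variables. A team $X$ is a finite set $\mathrm{dom}(X)$ of variables together with a set (also denoted $X$) of assignments with domain $\mathrm{dom}(X)$ (one empty team per domain). $s[\bar a/\bar x]$ denotes the assignment extending/modifying $s$ to send $x_i\mapsto a_i$. For a team $X$ and variable $x$: $\exists xX=\{s:\mathrm{dom}(X)\setminus\{x\}\to M\mid s[a/x]\in X\text{ for some }a\in M,\text{ or }s\in X\}$, $\forall xX=\{s:\mathrm{dom}(X)\setminus\{x\}\to M\mid s[a/x]\in X\text{ for all }a\in M,\text{ or }s\in X\}$, with domain $\mathrm{dom}(X)\setminus\{x\}$; for tuples these are iterated. A generalized quantifier $Q$ of type $\langle n\rangle$ is an isomorphism-closed class of structures $(M,R)$ with $R\subseteq M^n$; $Q_M=\{R\mid (M,R)\in Q\}$. mt-logic with $Q$ has formulas: literals, $\varphi\wedge^{\mathrm{in}}\psi$, $\varphi\vee^{\mathrm{in}}\psi$ (internal), $\varphi\wedge\psi$, $\varphi\vee\psi$ (external), $\exists x\varphi$, $\forall x\varphi$,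 $Q\bar x\varphi$ ($\bar x$ an $n$-tuple of distinct variables). Satisfaction (for $\mathrm{FV}(\varphi)\subseteq\mathrm{dom}(X)$): literal $\psi$: for all $s:\mathrm{dom}(X)\to M$, $s\in X$ iff $\mathcal M,s\models\psi$; $\varphi\wedge^{\mathrm{in}}\psi$: $X=Y\cap Z$ with $Y\models\varphi$, $Z\models\psi$ for some $Y,Z$; $\varphi\vee^{\mathrm{in}}\psi$: $X=Y\cup Z$ with $Y\models\varphi$, $Z\models\psi$; $\wedge$: both; $\vee$: one of them; $\exists x\varphi$: some $Y$ with $x\in\mathrm{dom}(Y)$, $\exists xY=\exists xX$, $Y\models\varphi$; $\forall x\varphi$: some $Y$ with $x\in\mathrm{dom}(Y)$, $\forall xY=\exists xX$, $Y\models\varphi$; $Q\bar x\varphi$: some $Y$ with $\bar x\subseteq\mathrm{dom}(Y)$, $Y\models\varphi$ and $\exists\bar xX=Q\bar xY$, where $Q\bar xY=\{s:\mathrm{dom}(Y)\setminus\{\bar x\}\to M\mid Y_s(\bar x)\in Q_M\}$, $Y_s=\{s':\mathrm{dom}(Y)\setminus\mathrm{dom}(s)\to M\mid s\cup s'\in Y\}$ and $Y_s(\bar x)=\{s'(\bar x)\mid s'\in Y_s\}$. $\mathrm{FO}(Q)$ formulas are those built without the external $\wedge,\vee$; they have classical Tarskian semantics with $\mathcal M,s\models Q\bar x\psi$ iff $\{\bar a\in M^n\mid \mathcal M,s[\bar a/\bar x]\models\psi\}\in Q_M$ (internal connectives read as ordinary $\wedge,\vee$). For such $\varphi$ with $\mathrm{FV}(\varphi)\subseteq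 V$, $[\![\varphi]\!]^{\mathcal M}_V=\{s:V\to M\mid\mathcal M,s\models\varphi\}$, a team with domain $V$. $\mathrm{BV}(\varphi)$ is the set of bound variables. A formula is untangled if no quantifier binding a variable $x$ occurs in the scope of another quantifier binding $x$, and no variable is both free and bound. -}

module Defs where

open import Data.Nat using (ℕ; _≟_; _≡ᵇ_)
open import Data.Bool using (if_then_else_)
open import Data.List using (List; []; _∷_; _++_; filter)
open import Data.List.Membership.Propositional using (_∈_; _∉_)
open import Data.List.Membership.DecPropositional _≟_ using (_∈?_)
open import Data.Vec as Vec using (Vec; []; _∷_; toList)
open import Data.Vec.Relation.Unary.Unique.Propositional using (Unique)
open import Data.Product using (Σ; _×_; _,_; ∃)
open import Data.Sum using (_⊎_)
open import Relation.Nullary using (¬_; ¬?)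
open import Relation.Binary.PropositionalEquality using (_≡_)
open import Function.Bundles using (_⇔_; _↔_; Inverse)

Var : Set
Var = ℕ

record Signature : Set₁ where
  field
    Fun      : Set
    funArity : Fun → ℕ
    Rel      : Set
    relArity : Rel → ℕ
open Signature public

module _ (S : Signature) where
  data Term : Set where
    var : Var → Term
    app : (f : Fun S) → Vec Term (funArity S f) → Term

  data Atom : Set where
    eq  : Term → Term → Atom
    rel : (r : Rel S) → Vec Term (relArity S r) → Atom

  data Literal : Set where
    pos : Atom → Literal
    neg : Atom → Literal

  data Formula (n : ℕ) : Set where
    lit   : Literal → Formula n
    _∧ⁱ_  : Formula n → Formula n → Formula n
    _∨ⁱ_  : Formula n → Formula n → Formula n
    _∧ᵉ_  : Formula n → Formula n → Formula n
    _∨ᵉ_  : Formula n → Formula n → Formula n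
    ex    : Var → Formula n → Formula n
    all   : Var → Formula n → Formula n
    gq    : (xs : Vec Var n) → Unique xs → Formula n → Formula n

removeVar : Var → List Var → List Var
removeVar x = filter (λ y → ¬? (y ≟ x))

removeVars : List Var → List Var → List Var
removeVars xs = filter (λ y → ¬? (y ∈? xs))


module _ {S : Signature} where
  mutual
    termVars : Term S → List Var
    termVars (var x)    = x ∷ []
    termVars (app f ts) = termsVars ts

    termsVars : ∀ {k} → Vec (Term S) k → List Var
    termsVars []       = []
    termsVars (t ∷ ts) = termVars t ++ termsVars ts

  atomVars : Atom S → List Var
  atomVars (eq t u)   = termVars t ++ termVars u
  atomVars (rel r ts) = termsVars ts

  litVars : Literal S → List Var
  litVars (pos a) = atomVars a
  litVars (neg a) = atomVars a

  FV : ∀ {n} → Formula S n → List Var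
  FV (lit l)     = litVars l
  FV (φ ∧ⁱ ψ)    = FV φ ++ FV ψ
  FV (φ ∨ⁱ ψ)    = FV φ ++ FV ψ
  FV (φ ∧ᵉ ψ)    = FV φ ++ FV ψ
  FV (φ ∨ᵉ ψ)    = FV φ ++ FV ψ
  FV (ex x φ)    = removeVar x (FV φ)
  FV (all x φ)   = removeVar x (FV φ)
  FV (gq xs _ φ) = removeVars (toList xs) (FV φ)

  BV : ∀ {n} → Formula S n → List Var
  BV (lit l)     = []
  BV (φ ∧ⁱ ψ)    = BV φ ++ BV ψ
  BV (φ ∨ⁱ ψ)    = BV φ ++ BV ψ
  BV (φ ∧ᵉ ψ)    = BV φ ++ BV ψ
  BV (φ ∨ᵉ ψ)    = BV φ ++ BV ψ
  BV (ex x φ)    = x ∷ BV φ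
  BV (all x φ)   = x ∷ BV φ
  BV (gq xs _ φ) = toList xs ++ BV φ

  data IsFOQ {n} : Formula S n → Set where
    lit  : ∀ l → IsFOQ (lit l)
    andᵢ : ∀ {φ ψ} → IsFOQ φ → IsFOQ ψ → IsFOQ (φ ∧ⁱ ψ)
    orᵢ  : ∀ {φ ψ} → IsFOQ φ → IsFOQ ψ → IsFOQ (φ ∨ⁱ ψ)
    ex   : ∀ {x φ} → IsFOQ φ → IsFOQ (ex x φ)
    all  : ∀ {x φ} → IsFOQ φ → IsFOQ (all x φ)
    gq   : ∀ {xs u φ} → IsFOQ φ → IsFOQ (gq xs u φ)

  -- No quantifier binding x occurs in the scope of another quantifier
  -- binding x; the argument is the list of variables bound by the
  -- enclosing quantifiers.
  NoRebind : ∀ {n} → List Var → Formula S n → Set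
  NoRebind B (lit l)     = Data.Unit.⊤ where import Data.Unit
  NoRebind B (φ ∧ⁱ ψ)    = NoRebind B φ × NoRebind B ψ
  NoRebind B (φ ∨ⁱ ψ)    = NoRebind B φ × NoRebind B ψ
  NoRebind B (φ ∧ᵉ ψ)    = NoRebind B φ × NoRebind B ψ
  NoRebind B (φ ∨ᵉ ψ)    = NoRebind B φ × NoRebind B ψ
  NoRebind B (ex x φ)    = x ∉ B × NoRebind (x ∷ B) φ
  NoRebind B (all x φ)   = x ∉ B × NoRebind (x ∷ B) φ
  NoRebind B (gq xs _ φ) = (∀ x → x ∈ toList xs → x ∉ B) × NoRebind (toList xs ++ B) φ

  Untangled : ∀ {n} → Formula S n → Set
  Untangled φ = NoRebind [] φ × (∀ x → x ∈ FV φ → x ∉ BV φ)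

-- A structure; the universe is nonempty (standard convention).
record Structure (S : Signature) : Set₁ where
  field
    Carrier : Set
    elem    : Carrier
    funI    : (f : Fun S) → Vec Carrier (funArity S f) → Carrier
    relI    : (r : Rel S) → Vec Carrier (relArity S r) → Set
open Structure public

record GenQuantifier (n : ℕ) : Set₁ where
  field
    Q         : (N : Set) → (Vec N n → Set) → Set
    isoClosed : ∀ {N N′ : Set} (f : N ↔ N′) (R : Vec N n → Set) (R′ : Vec N′ n → Set) →
                (∀ v → R v ⇔ R′ (Vec.map (Inverse.to f) v)) → Q N R → Q N′ R′
open GenQuantifier public

module Semantics {S : Signature} (𝓜 : Structure S) {n : ℕ} (𝑸 : GenQuantifier n) where

  M : Set
  M = Carrier 𝓜

  -- An assignment with domain V is represented by a total function
  -- ℕ → M, of which only the values on V matter.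
  Assignment : Set
  Assignment = Var → M

  _[_/_] : Assignment → M → Var → Assignment
  (s [ a / x ]) y = if y ≡ᵇ x then a else s y

  _[_//_] : ∀ {k} → Assignment → Vec M k → Vec Var k → Assignment
  s [ [] // [] ] = s
  s [ a ∷ as // x ∷ xs ] = (s [ a / x ]) [ as // xs ]

  record Team : Set₁ where
    field
      dom : List Var
      mem : Assignment → Set
  open Team public

  -- X is a genuine set of assignments with domain dom X
  IsTeam : Team → Set
  IsTeam X = ∀ s s′ → (∀ x → x ∈ dom X → s x ≡ s′ x) → mem X s → mem X s′

  _≐ᵈ_ : List Var → List Var → Set
  V ≐ᵈ W = ∀ x → (x ∈ V) ⇔ (x ∈ W)

  _≐_ : Team → Team → Set
  X ≐ Y = (dom X ≐ᵈ dom Y) × (∀ s → mem X s ⇔ mem Y s)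

  ∃ₓ : Var → Team → Team
  ∃ₓ x X = record
    { dom = removeVar x (dom X)
    ; mem = λ s → (x ∈ dom X × Σ M (λ a → mem X (s [ a / x ]))) ⊎ (x ∉ dom X × mem X s) }

  ∀ₓ : Var → Team → Team
  ∀ₓ x X = record
    { dom = removeVar x (dom X)
    ; mem = λ s → (x ∈ dom X × ((a : M) → mem X (s [ a / x ]))) ⊎ (x ∉ dom X × mem X s) }

  ∃ᵥ : ∀ {k} → Vec Var k → Team → Team
  ∃ᵥ []       X = X
  ∃ᵥ (x ∷ xs) X = ∃ₓ x (∃ᵥ xs X)

  -- Q x̄ Y ; for s with domain dom Y ∖ x̄ (and x̄ ⊆ dom Y),
  -- Y_s(x̄) = { s′(x̄) | s ∪ s′ ∈ Y } = { v | s[v/x̄] ∈ Y }.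
  Qₓ : Vec Var n → Team → Team
  Qₓ xs Y = record
    { dom = removeVars (toList xs) (dom Y)
    ; mem = λ s → Q 𝑸 M (λ v → mem Y (s [ v // xs ])) }

  mutual
    evalT : Assignment → Term S → M
    evalT s (var x)    = s x
    evalT s (app f ts) = funI 𝓜 f (evalTs s ts)

    evalTs : ∀ {k} → Assignment → Vec (Term S) k → Vec M k
    evalTs s []       = []
    evalTs s (t ∷ ts) = evalT s t ∷ evalTs s ts

  satAtom : Assignment → Atom S → Set
  satAtom s (eq t u)   = evalT s t ≡ evalT s u
  satAtom s (rel r ts) = relI 𝓜 r (evalTs s ts)

  satLit : Assignment → Literal S → Set
  satLit s (pos a) = satAtom s a
  satLit s (neg a) = ¬ satAtom s a

  -- (meant for FO(Q) formulas; external connectives are read classically too)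
  _⊨ᵀ_ : Assignment → Formula S n → Set
  s ⊨ᵀ lit l     = satLit s l
  s ⊨ᵀ (φ ∧ⁱ ψ)  = (s ⊨ᵀ φ) × (s ⊨ᵀ ψ)
  s ⊨ᵀ (φ ∨ⁱ ψ)  = (s ⊨ᵀ φ) ⊎ (s ⊨ᵀ ψ)
  s ⊨ᵀ (φ ∧ᵉ ψ)  = (s ⊨ᵀ φ) × (s ⊨ᵀ ψ)
  s ⊨ᵀ (φ ∨ᵉ ψ)  = (s ⊨ᵀ φ) ⊎ (s ⊨ᵀ ψ)
  s ⊨ᵀ ex x φ    = Σ M (λ a → (s [ a / x ]) ⊨ᵀ φ)
  s ⊨ᵀ all x φ   = (a : M) → (s [ a / x ]) ⊨ᵀ φ
  s ⊨ᵀ gq xs _ φ = Q 𝑸 M (λ v → (s [ v // xs ]) ⊨ᵀ φ)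

  ⟦_⟧_ : Formula S n → List Var → Team
  ⟦ φ ⟧ V = record { dom = V ; mem = λ s → s ⊨ᵀ φ }

  _⊨_ : Team → Formula S n → Set₁
  X ⊨ lit l     = Lift (Level.suc Level.zero) (∀ s → mem X s ⇔ satLit s l)
    where import Level; open Level using (Lift)
  X ⊨ (φ ∧ⁱ ψ)  = Σ Team λ Y → Σ Team λ Z → IsTeam Y × IsTeam Z ×
                    (dom Y ≐ᵈ dom X) × (dom Z ≐ᵈ dom X) ×
                    (∀ s → mem X s ⇔ (mem Y s × mem Z s)) × (Y ⊨ φ) × (Z ⊨ ψ)
  X ⊨ (φ ∨ⁱ ψ)  = Σ Team λ Y → Σ Team λ Z → IsTeam Y × IsTeam Z ×
                    (dom Y ≐ᵈ dom X) × (dom Z ≐ᵈ dom X) ×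
                    (∀ s → mem X s ⇔ (mem Y s ⊎ mem Z s)) × (Y ⊨ φ) × (Z ⊨ ψ)
  X ⊨ (φ ∧ᵉ ψ)  = (X ⊨ φ) × (X ⊨ ψ)
  X ⊨ (φ ∨ᵉ ψ)  = (X ⊨ φ) ⊎ (X ⊨ ψ)
  X ⊨ ex x φ    = Σ Team λ Y → IsTeam Y × x ∈ dom Y × (∃ₓ x Y ≐ ∃ₓ x X) × (Y ⊨ φ)
  X ⊨ all x φ   = Σ Team λ Y → IsTeam Y × x ∈ dom Y × (∀ₓ x Y ≐ ∃ₓ x X) × (Y ⊨ φ)
  X ⊨ gq xs _ φ = Σ Team λ Y → IsTeam Y × (∀ x → x ∈ toList xs → x ∈ dom Y) ×
                    (Y ⊨ φ) × (∃ᵥ xs X ≐ Qₓ xs Y)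

-- Induction on φ with the invariant NoRebind (dom X) φ: no quantifier of φ binds a variable
-- of dom X or one already bound above it (at the root this is untangledness together with
-- BV φ ∩ dom X = ∅).  Freshness makes ∃x X and ∃x̄ X equal to X, so each team-semantic
-- quantifier clause collapses to the Tarskian one for the witnessing team Y; conversely the
-- flat teams ⟦ψ⟧ over the extended domains are witnesses, and they are teams by the
-- coincidence lemma.
module Submission where

open import Defs
open import Data.List.Membership.Propositional using (_∈_; _∉_)
open import Function.Bundles using (_⇔_)

open import Level using (0ℓ; lift)
open import Data.Nat using (ℕ; _≟_; _≡ᵇ_)
open import Data.Nat.Properties using (≡⇒≡ᵇ)
open import Data.Bool using (true; false; T)
open import Data.Unit using (tt)
open import Data.Empty using (⊥-elim)
open import Data.List using (List; _∷_; _++_)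
open import Data.List.Properties using (++-assoc; filter-++; filter-none; filter-reject)
open import Data.List.Relation.Unary.Any using (here; there)
open import Data.List.Relation.Unary.All using (tabulate)
open import Data.List.Relation.Binary.Subset.Propositional using (_⊆_)
open import Data.List.Relation.Binary.Subset.Propositional.Properties
  using (⊆-trans; ∷⁺ʳ; ++⁺ʳ; xs⊆xs++ys; xs⊆ys++xs; filter-⊆)
open import Data.List.Membership.Propositional.Properties using (∈-++⁺ˡ; ∈-++⁺ʳ; ∈-++⁻; ∈-filter⁺; ∈-filter⁻)
open import Data.List.Membership.DecPropositional _≟_ using (_∈?_)
open import Data.Vec using (Vec; []; _∷_; toList)
open import Data.Vec.Properties using (map-id)
open import Data.Product using (Σ; _×_; _,_)
open import Data.Product.Function.NonDependent.Propositional using (_×-⇔_)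
open import Data.Product.Function.Dependent.Propositional using (Σ-⇔)
open import Data.Sum using (inj₁; inj₂; [_,_])
open import Data.Sum.Function.Propositional using (_⊎-⇔_)
open import Relation.Nullary using (¬?; yes; no)
open import Relation.Binary.PropositionalEquality using (_≡_; _≢_; refl; sym; trans; subst; cong; cong₂)
open import Function.Base using (_∘_)
open import Function.Bundles using (mk⇔; Equivalence)
open import Function.Construct.Symmetry using (⇔-sym)
open import Function.Construct.Identity using (⇔-id; ↠-id)
open import Function.Properties.Equivalence using (⇔-setoid) renaming (trans to ⇔-trans)
open import Function.Properties.Inverse using (↔-refl)

open Equivalence

∈-removeVar⁺ : ∀ {x y V} → y ∈ V → y ≢ x → y ∈ removeVar x V
∈-removeVar⁺ {x} = ∈-filter⁺ (λ z → ¬? (z ≟ x))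

∈-removeVar⁻ : ∀ {x y V} → y ∈ removeVar x V → y ∈ V × y ≢ x
∈-removeVar⁻ {x} = ∈-filter⁻ (λ z → ¬? (z ≟ x))

∈-removeVars⁺ : ∀ {xs y V} → y ∈ V → y ∉ xs → y ∈ removeVars xs V
∈-removeVars⁺ {xs} = ∈-filter⁺ (λ z → ¬? (z ∈? xs))

∈-removeVars⁻ : ∀ {xs y V} → y ∈ removeVars xs V → y ∈ V × y ∉ xs
∈-removeVars⁻ {xs} = ∈-filter⁻ (λ z → ¬? (z ∈? xs))

removeVar-⊆ : ∀ x V → removeVar x V ⊆ V
removeVar-⊆ x = filter-⊆ (λ z → ¬? (z ≟ x))

removeVars-⊆ : ∀ xs V → removeVars xs V ⊆ V
removeVars-⊆ xs = filter-⊆ (λ z → ¬? (z ∈? xs))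

removeVar-∷ : ∀ x V → removeVar x (x ∷ V) ≡ removeVar x V
removeVar-∷ x V = filter-reject (λ z → ¬? (z ≟ x)) (λ x≢x → x≢x refl)

removeVars-++ : ∀ xs V → removeVars xs (xs ++ V) ≡ removeVars xs V
removeVars-++ xs V =
  trans (filter-++ (λ z → ¬? (z ∈? xs)) xs V)
        (cong (_++ removeVars xs V) (filter-none (λ z → ¬? (z ∈? xs)) (tabulate (λ y∈xs y∉xs → y∉xs y∈xs))))

⊆-∷-removeVar : ∀ {x A B} → removeVar x A ⊆ B → A ⊆ x ∷ B
⊆-∷-removeVar {x} sub {y} y∈A with y ≟ x
... | yes refl = here refl
... | no y≢x   = there (sub (∈-removeVar⁺ y∈A y≢x))

⊆-++-removeVars : ∀ {xs A B} → removeVars xs A ⊆ B → A ⊆ xs ++ B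
⊆-++-removeVars {xs} sub {y} y∈A with y ∈? xs
... | yes y∈xs = ∈-++⁺ˡ y∈xs
... | no y∉xs  = ∈-++⁺ʳ xs (sub (∈-removeVars⁺ y∈A y∉xs))

module _ {S : Signature} {n : ℕ} where

  NoRebind-⊆ : ∀ {B C} (φ : Formula S n) → C ⊆ B → NoRebind B φ → NoRebind C φ
  NoRebind-⊆ (lit l)     C⊆B _          = tt
  NoRebind-⊆ (φ ∧ⁱ ψ)    C⊆B (nφ , nψ)  = NoRebind-⊆ φ C⊆B nφ , NoRebind-⊆ ψ C⊆B nψ
  NoRebind-⊆ (φ ∨ⁱ ψ)    C⊆B (nφ , nψ)  = NoRebind-⊆ φ C⊆B nφ , NoRebind-⊆ ψ C⊆B nψ
  NoRebind-⊆ (φ ∧ᵉ ψ)    C⊆B (nφ , nψ)  = NoRebind-⊆ φ C⊆B nφ , NoRebind-⊆ ψ C⊆B nψ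
  NoRebind-⊆ (φ ∨ᵉ ψ)    C⊆B (nφ , nψ)  = NoRebind-⊆ φ C⊆B nφ , NoRebind-⊆ ψ C⊆B nψ
  NoRebind-⊆ (ex x φ)    C⊆B (x∉B , nφ) = (λ x∈C → x∉B (C⊆B x∈C)) , NoRebind-⊆ φ (∷⁺ʳ x C⊆B) nφ
  NoRebind-⊆ (all x φ)   C⊆B (x∉B , nφ) = (λ x∈C → x∉B (C⊆B x∈C)) , NoRebind-⊆ φ (∷⁺ʳ x C⊆B) nφ
  NoRebind-⊆ (gq xs _ φ) C⊆B (xs#B , nφ) =
    (λ y y∈xs y∈C → xs#B y y∈xs (C⊆B y∈C)) , NoRebind-⊆ φ (++⁺ʳ (toList xs) C⊆B) nφ

  NoRebind-++ : ∀ {B V} (φ : Formula S n) → NoRebind B φ → (∀ y → y ∈ BV φ → y ∉ V) →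
                NoRebind (B ++ V) φ
  NoRebind-++ (lit l) _ _ = tt
  NoRebind-++ (φ ∧ⁱ ψ) (nφ , nψ) BV#V =
    NoRebind-++ φ nφ (λ y p → BV#V y (∈-++⁺ˡ p)) , NoRebind-++ ψ nψ (λ y p → BV#V y (∈-++⁺ʳ (BV φ) p))
  NoRebind-++ (φ ∨ⁱ ψ) (nφ , nψ) BV#V =
    NoRebind-++ φ nφ (λ y p → BV#V y (∈-++⁺ˡ p)) , NoRebind-++ ψ nψ (λ y p → BV#V y (∈-++⁺ʳ (BV φ) p))
  NoRebind-++ (φ ∧ᵉ ψ) (nφ , nψ) BV#V =
    NoRebind-++ φ nφ (λ y p → BV#V y (∈-++⁺ˡ p)) , NoRebind-++ ψ nψ (λ y p → BV#V y (∈-++⁺ʳ (BV φ) p))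
  NoRebind-++ (φ ∨ᵉ ψ) (nφ , nψ) BV#V =
    NoRebind-++ φ nφ (λ y p → BV#V y (∈-++⁺ˡ p)) , NoRebind-++ ψ nψ (λ y p → BV#V y (∈-++⁺ʳ (BV φ) p))
  NoRebind-++ {B} (ex x φ) (x∉B , nφ) BV#V =
    [ x∉B , BV#V x (here refl) ] ∘ ∈-++⁻ B , NoRebind-++ φ nφ (λ y → BV#V y ∘ there)
  NoRebind-++ {B} (all x φ) (x∉B , nφ) BV#V =
    [ x∉B , BV#V x (here refl) ] ∘ ∈-++⁻ B , NoRebind-++ φ nφ (λ y → BV#V y ∘ there)
  NoRebind-++ {B} {V} (gq xs _ φ) (xs#B , nφ) BV#V =
    (λ y y∈xs → [ xs#B y y∈xs , BV#V y (∈-++⁺ˡ y∈xs) ] ∘ ∈-++⁻ B) ,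
    subst (λ C → NoRebind C φ) (++-assoc (toList xs) B V)
          (NoRebind-++ φ nφ (λ y → BV#V y ∘ ∈-++⁺ʳ (toList xs)))

Π-⇔ : ∀ {A : Set} {P R : A → Set} → (∀ a → P a ⇔ R a) → ((a : A) → P a) ⇔ ((a : A) → R a)
Π-⇔ P⇔R = mk⇔ (λ f a → to (P⇔R a) (f a)) (λ g a → from (P⇔R a) (g a))

module _ {S : Signature} (𝓜 : Structure S) {n : ℕ} (𝑸 : GenQuantifier n) where
  open Semantics 𝓜 𝑸
  open import Relation.Binary.Reasoning.Setoid (⇔-setoid 0ℓ)

  Q-⇔ : ∀ {R R′ : Vec M n → Set} → (∀ v → R v ⇔ R′ v) → Q 𝑸 M R ⇔ Q 𝑸 M R′
  Q-⇔ R⇔R′ = mk⇔ (resp R⇔R′) (resp (λ v → ⇔-sym (R⇔R′ v)))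
    where
    resp : ∀ {R R′ : Vec M n → Set} → (∀ v → R v ⇔ R′ v) → Q 𝑸 M R → Q 𝑸 M R′
    resp {R} {R′} R⇔R′ = isoClosed 𝑸 ↔-refl R R′ (λ v → subst (λ w → R v ⇔ R′ w) (sym (map-id v)) (R⇔R′ v))

  _≗[_]_ : Assignment → List Var → Assignment → Set
  s ≗[ V ] s′ = ∀ y → y ∈ V → s y ≡ s′ y

  ≗[]-sym : ∀ {s s′ V} → s ≗[ V ] s′ → s′ ≗[ V ] s
  ≗[]-sym s≗s′ y y∈V = sym (s≗s′ y y∈V)

  ≗[]-⊆ : ∀ {s s′ V W} → V ⊆ W → s ≗[ W ] s′ → s ≗[ V ] s′
  ≗[]-⊆ V⊆W s≗s′ y y∈V = s≗s′ y (V⊆W y∈V)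

  ≗[]-++ˡ : ∀ {s s′ V W} → s ≗[ V ++ W ] s′ → s ≗[ V ] s′
  ≗[]-++ˡ = ≗[]-⊆ (xs⊆xs++ys _ _)

  ≗[]-++ʳ : ∀ {s s′ V W} → s ≗[ V ++ W ] s′ → s ≗[ W ] s′
  ≗[]-++ʳ {V = V} = ≗[]-⊆ (xs⊆ys++xs _ V)

  [/]-cong : ∀ {s s′ V} x a → s ≗[ removeVar x V ] s′ → (s [ a / x ]) ≗[ V ] (s′ [ a / x ])
  [/]-cong x a s≗s′ y y∈V with y ≡ᵇ x in y≡ᵇx
  ... | true  = refl
  ... | false = s≗s′ y (∈-removeVar⁺ y∈V (λ y≡x → subst T y≡ᵇx (≡⇒≡ᵇ y x y≡x)))

  [//]-cong : ∀ {k s s′ V} (xs : Vec Var k) (v : Vec M k) →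
              s ≗[ removeVars (toList xs) V ] s′ → (s [ v // xs ]) ≗[ V ] (s′ [ v // xs ])
  [//]-cong [] [] s≗s′ y y∈V = s≗s′ y (∈-removeVars⁺ y∈V (λ ()))
  [//]-cong {V = V} (x ∷ xs) (a ∷ v) s≗s′ = [//]-cong xs v ([/]-cong x a (λ y y∈ → s≗s′ y (fresh y∈)))
    where
    fresh : ∀ {y} → y ∈ removeVar x (removeVars (toList xs) V) → y ∈ removeVars (x ∷ toList xs) V
    fresh y∈ with ∈-removeVar⁻ {V = removeVars (toList xs) V} y∈
    ... | y∈V∖xs , y≢x with ∈-removeVars⁻ {V = V} y∈V∖xs
    ...   | y∈V , y∉xs = ∈-removeVars⁺ y∈V (λ { (here y≡x) → y≢x y≡x ; (there y∈xs) → y∉xs y∈xs })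

  mutual
    evalT-cong : ∀ {s s′} t → s ≗[ termVars t ] s′ → evalT s t ≡ evalT s′ t
    evalT-cong (var x)    s≗s′ = s≗s′ x (here refl)
    evalT-cong (app f ts) s≗s′ = cong (funI 𝓜 f) (evalTs-cong ts s≗s′)

    evalTs-cong : ∀ {k s s′} (ts : Vec (Term S) k) → s ≗[ termsVars ts ] s′ → evalTs s ts ≡ evalTs s′ ts
    evalTs-cong []       s≗s′ = refl
    evalTs-cong (t ∷ ts) s≗s′ =
      cong₂ _∷_ (evalT-cong t (≗[]-++ˡ s≗s′)) (evalTs-cong ts (≗[]-++ʳ s≗s′))

  satAtom-cong : ∀ {s s′} a → s ≗[ atomVars a ] s′ → satAtom s a → satAtom s′ a
  satAtom-cong (eq t u) s≗s′ t≡u =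
    trans (sym (evalT-cong t (≗[]-++ˡ s≗s′)))
          (trans t≡u (evalT-cong u (≗[]-++ʳ s≗s′)))
  satAtom-cong (rel r ts) s≗s′ = subst (relI 𝓜 r) (evalTs-cong ts s≗s′)

  satLit-cong : ∀ {s s′} l → s ≗[ litVars l ] s′ → satLit s l → satLit s′ l
  satLit-cong (pos a) s≗s′ = satAtom-cong a s≗s′
  satLit-cong (neg a) s≗s′ ¬sa s′a = ¬sa (satAtom-cong a (≗[]-sym s≗s′) s′a)

  ⊨ᵀ-cong : ∀ {s s′} φ → s ≗[ FV φ ] s′ → s ⊨ᵀ φ → s′ ⊨ᵀ φ
  ⊨ᵀ-cong (lit l) s≗s′ = satLit-cong l s≗s′
  ⊨ᵀ-cong (φ ∧ⁱ ψ) s≗s′ (sφ , sψ) = ⊨ᵀ-cong φ (≗[]-++ˡ s≗s′) sφ , ⊨ᵀ-cong ψ (≗[]-++ʳ s≗s′) sψ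
  ⊨ᵀ-cong (φ ∧ᵉ ψ) s≗s′ (sφ , sψ) = ⊨ᵀ-cong φ (≗[]-++ˡ s≗s′) sφ , ⊨ᵀ-cong ψ (≗[]-++ʳ s≗s′) sψ
  ⊨ᵀ-cong (φ ∨ⁱ ψ) s≗s′ (inj₁ sφ) = inj₁ (⊨ᵀ-cong φ (≗[]-++ˡ s≗s′) sφ)
  ⊨ᵀ-cong (φ ∨ⁱ ψ) s≗s′ (inj₂ sψ) = inj₂ (⊨ᵀ-cong ψ (≗[]-++ʳ s≗s′) sψ)
  ⊨ᵀ-cong (φ ∨ᵉ ψ) s≗s′ (inj₁ sφ) = inj₁ (⊨ᵀ-cong φ (≗[]-++ˡ s≗s′) sφ)
  ⊨ᵀ-cong (φ ∨ᵉ ψ) s≗s′ (inj₂ sψ) = inj₂ (⊨ᵀ-cong ψ (≗[]-++ʳ s≗s′) sψ)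
  ⊨ᵀ-cong (ex x φ)    s≗s′ (a , sφ) = a , ⊨ᵀ-cong φ ([/]-cong x a s≗s′) sφ
  ⊨ᵀ-cong (all x φ)   s≗s′ sφ a     = ⊨ᵀ-cong φ ([/]-cong x a s≗s′) (sφ a)
  ⊨ᵀ-cong (gq xs _ φ) s≗s′ =
    to (Q-⇔ λ v → mk⇔ (⊨ᵀ-cong φ ([//]-cong xs v s≗s′)) (⊨ᵀ-cong φ ([//]-cong xs v (≗[]-sym s≗s′))))

  ⟦⟧-isTeam : ∀ φ {V} → FV φ ⊆ V → IsTeam (⟦ φ ⟧ V)
  ⟦⟧-isTeam φ FV⊆V s s′ s≗s′ = ⊨ᵀ-cong φ (≗[]-⊆ FV⊆V s≗s′)

  ≐ᵈ-reflexive : ∀ {V W} → V ≡ W → V ≐ᵈ W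
  ≐ᵈ-reflexive refl _ = ⇔-id _

  ∃ₓ-fresh : ∀ {x} X {s} → x ∉ dom X → mem (∃ₓ x X) s ⇔ mem X s
  ∃ₓ-fresh X x∉X = mk⇔ (λ { (inj₁ (x∈X , _)) → ⊥-elim (x∉X x∈X) ; (inj₂ (_ , s∈X)) → s∈X })
                       (λ s∈X → inj₂ (x∉X , s∈X))

  ∃ₓ-bound : ∀ {x} X {s} → x ∈ dom X → mem (∃ₓ x X) s ⇔ Σ M (λ a → mem X (s [ a / x ]))
  ∃ₓ-bound X x∈X = mk⇔ (λ { (inj₁ (_ , s∈)) → s∈ ; (inj₂ (x∉X , _)) → ⊥-elim (x∉X x∈X) })
                       (λ s∈ → inj₁ (x∈X , s∈))

  ∀ₓ-bound : ∀ {x} X {s} → x ∈ dom X → mem (∀ₓ x X) s ⇔ ((a : M) → mem X (s [ a / x ]))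
  ∀ₓ-bound X x∈X = mk⇔ (λ { (inj₁ (_ , s∈)) → s∈ ; (inj₂ (x∉X , _)) → ⊥-elim (x∉X x∈X) })
                       (λ s∈ → inj₁ (x∈X , s∈))

  dom-∃ᵥ : ∀ {k} (xs : Vec Var k) X → dom (∃ᵥ xs X) ≐ᵈ removeVars (toList xs) (dom X)
  dom-∃ᵥ []       X y = mk⇔ (λ y∈X → ∈-removeVars⁺ y∈X (λ ())) (removeVars-⊆ _ _)
  dom-∃ᵥ (x ∷ xs) X y = mk⇔ shrink grow
    where
    shrink : y ∈ removeVar x (dom (∃ᵥ xs X)) → y ∈ removeVars (x ∷ toList xs) (dom X)
    shrink y∈ with ∈-removeVar⁻ {V = dom (∃ᵥ xs X)} y∈
    ... | y∈∃X , y≢x with ∈-removeVars⁻ {V = dom X} (to (dom-∃ᵥ xs X y) y∈∃X)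
    ...   | y∈X , y∉xs = ∈-removeVars⁺ y∈X (λ { (here y≡x) → y≢x y≡x ; (there y∈xs) → y∉xs y∈xs })
    grow : y ∈ removeVars (x ∷ toList xs) (dom X) → y ∈ removeVar x (dom (∃ᵥ xs X))
    grow y∈ with ∈-removeVars⁻ {V = dom X} y∈
    ... | y∈X , y∉x∷xs =
      ∈-removeVar⁺ (from (dom-∃ᵥ xs X y) (∈-removeVars⁺ y∈X (y∉x∷xs ∘ there))) (y∉x∷xs ∘ here)

  dom-∃ᵥ-⊆ : ∀ {k} (xs : Vec Var k) X → dom (∃ᵥ xs X) ⊆ dom X
  dom-∃ᵥ-⊆ xs X y∈ = removeVars-⊆ _ _ (to (dom-∃ᵥ xs X _) y∈)

  ∃ᵥ-fresh : ∀ {k} (xs : Vec Var k) X {s} → (∀ y → y ∈ toList xs → y ∉ dom X) → mem (∃ᵥ xs X) s ⇔ mem X s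
  ∃ᵥ-fresh []       X _    = ⇔-id _
  ∃ᵥ-fresh (x ∷ xs) X xs#X =
    ⇔-trans (∃ₓ-fresh (∃ᵥ xs X) (xs#X x (here refl) ∘ dom-∃ᵥ-⊆ xs X)) (∃ᵥ-fresh xs X (λ y → xs#X y ∘ there))

  infix 4 _≐⟦_⟧
  _≐⟦_⟧ : Team → Formula S n → Set
  X ≐⟦ φ ⟧ = ∀ s → mem X s ⇔ (s ⊨ᵀ φ)

  ⟦⟧-≐⟦⟧ : ∀ φ V → ⟦ φ ⟧ V ≐⟦ φ ⟧
  ⟦⟧-≐⟦⟧ φ V _ = ⇔-id _

  ⊨⇒≐⟦⟧ : ∀ {φ X} → IsFOQ φ → NoRebind (dom X) φ → X ⊨ φ → X ≐⟦ φ ⟧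
  ⊨⇒≐⟦⟧ (lit l) _ (lift X≐l) = X≐l
  ⊨⇒≐⟦⟧ (andᵢ fφ fψ) (nφ , nψ) (Y , Z , _ , _ , Y≐ᵈX , Z≐ᵈX , X≐Y∩Z , Y⊨φ , Z⊨ψ) s =
    ⇔-trans (X≐Y∩Z s)
      (⊨⇒≐⟦⟧ fφ (NoRebind-⊆ _ (to (Y≐ᵈX _)) nφ) Y⊨φ s
       ×-⇔ ⊨⇒≐⟦⟧ fψ (NoRebind-⊆ _ (to (Z≐ᵈX _)) nψ) Z⊨ψ s)
  ⊨⇒≐⟦⟧ (orᵢ fφ fψ) (nφ , nψ) (Y , Z , _ , _ , Y≐ᵈX , Z≐ᵈX , X≐Y∪Z , Y⊨φ , Z⊨ψ) s =
    ⇔-trans (X≐Y∪Z s)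
      (⊨⇒≐⟦⟧ fφ (NoRebind-⊆ _ (to (Y≐ᵈX _)) nφ) Y⊨φ s
       ⊎-⇔ ⊨⇒≐⟦⟧ fψ (NoRebind-⊆ _ (to (Z≐ᵈX _)) nψ) Z⊨ψ s)
  ⊨⇒≐⟦⟧ {ex x φ} {X} (ex fφ) (x∉X , nφ) (Y , _ , x∈Y , (∃Y≐ᵈ∃X , ∃Y≐∃X) , Y⊨φ) s = begin
    mem X s                          ≈⟨ ∃ₓ-fresh X x∉X ⟨
    mem (∃ₓ x X) s                   ≈⟨ ∃Y≐∃X s ⟨
    mem (∃ₓ x Y) s                   ≈⟨ ∃ₓ-bound Y x∈Y ⟩
    Σ M (λ a → mem Y (s [ a / x ]))  ≈⟨ Σ-⇔ (↠-id M) (Y≐φ _) ⟩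
    s ⊨ᵀ ex x φ                      ∎
    where
    Y≐φ : Y ≐⟦ φ ⟧
    Y≐φ = ⊨⇒≐⟦⟧ fφ (NoRebind-⊆ φ (⊆-∷-removeVar (removeVar-⊆ x _ ∘ to (∃Y≐ᵈ∃X _))) nφ) Y⊨φ
  ⊨⇒≐⟦⟧ {all x φ} {X} (all fφ) (x∉X , nφ) (Y , _ , x∈Y , (∀Y≐ᵈ∃X , ∀Y≐∃X) , Y⊨φ) s = begin
    mem X s                            ≈⟨ ∃ₓ-fresh X x∉X ⟨
    mem (∃ₓ x X) s                     ≈⟨ ∀Y≐∃X s ⟨
    mem (∀ₓ x Y) s                     ≈⟨ ∀ₓ-bound Y x∈Y ⟩
    ((a : M) → mem Y (s [ a / x ]))    ≈⟨ Π-⇔ (λ a → Y≐φ _) ⟩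
    s ⊨ᵀ all x φ                       ∎
    where
    Y≐φ : Y ≐⟦ φ ⟧
    Y≐φ = ⊨⇒≐⟦⟧ fφ (NoRebind-⊆ φ (⊆-∷-removeVar (removeVar-⊆ x _ ∘ to (∀Y≐ᵈ∃X _))) nφ) Y⊨φ
  ⊨⇒≐⟦⟧ {gq xs u φ} {X} (gq fφ) (xs#X , nφ) (Y , _ , _ , Y⊨φ , (∃X≐ᵈQY , ∃X≐QY)) s = begin
    mem X s                                   ≈⟨ ∃ᵥ-fresh xs X xs#X ⟨
    mem (∃ᵥ xs X) s                           ≈⟨ ∃X≐QY s ⟩
    Q 𝑸 M (λ v → mem Y (s [ v // xs ]))       ≈⟨ Q-⇔ (λ v → Y≐φ _) ⟩
    s ⊨ᵀ gq xs u φ                            ∎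
    where
    Y≐φ : Y ≐⟦ φ ⟧
    Y≐φ = ⊨⇒≐⟦⟧ fφ (NoRebind-⊆ φ (⊆-++-removeVars (dom-∃ᵥ-⊆ xs X ∘ from (∃X≐ᵈQY _))) nφ) Y⊨φ

  ≐⟦⟧⇒⊨ : ∀ {φ X} → IsFOQ φ → NoRebind (dom X) φ → FV φ ⊆ dom X → X ≐⟦ φ ⟧ → X ⊨ φ
  ≐⟦⟧⇒⊨ (lit l) _ _ X≐l = lift X≐l
  ≐⟦⟧⇒⊨ {φ ∧ⁱ ψ} {X} (andᵢ fφ fψ) (nφ , nψ) FV⊆X X≐φ∧ψ =
    ⟦ φ ⟧ dom X , ⟦ ψ ⟧ dom X , ⟦⟧-isTeam φ FVφ⊆X , ⟦⟧-isTeam ψ FVψ⊆X ,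
    ≐ᵈ-reflexive refl , ≐ᵈ-reflexive refl , X≐φ∧ψ ,
    ≐⟦⟧⇒⊨ fφ nφ FVφ⊆X (⟦⟧-≐⟦⟧ φ (dom X)) , ≐⟦⟧⇒⊨ fψ nψ FVψ⊆X (⟦⟧-≐⟦⟧ ψ (dom X))
    where
    FVφ⊆X : FV φ ⊆ dom X
    FVφ⊆X = ⊆-trans (xs⊆xs++ys (FV φ) (FV ψ)) FV⊆X
    FVψ⊆X : FV ψ ⊆ dom X
    FVψ⊆X = ⊆-trans (xs⊆ys++xs (FV ψ) (FV φ)) FV⊆X
  ≐⟦⟧⇒⊨ {φ ∨ⁱ ψ} {X} (orᵢ fφ fψ) (nφ , nψ) FV⊆X X≐φ∨ψ =
    ⟦ φ ⟧ dom X , ⟦ ψ ⟧ dom X , ⟦⟧-isTeam φ FVφ⊆X , ⟦⟧-isTeam ψ FVψ⊆X ,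
    ≐ᵈ-reflexive refl , ≐ᵈ-reflexive refl , X≐φ∨ψ ,
    ≐⟦⟧⇒⊨ fφ nφ FVφ⊆X (⟦⟧-≐⟦⟧ φ (dom X)) , ≐⟦⟧⇒⊨ fψ nψ FVψ⊆X (⟦⟧-≐⟦⟧ ψ (dom X))
    where
    FVφ⊆X : FV φ ⊆ dom X
    FVφ⊆X = ⊆-trans (xs⊆xs++ys (FV φ) (FV ψ)) FV⊆X
    FVψ⊆X : FV ψ ⊆ dom X
    FVψ⊆X = ⊆-trans (xs⊆ys++xs (FV ψ) (FV φ)) FV⊆X
  ≐⟦⟧⇒⊨ {ex x φ} {X} (ex fφ) (x∉X , nφ) FV⊆X X≐∃φ =
    Y , ⟦⟧-isTeam φ FVφ⊆Y , here refl , (≐ᵈ-reflexive (removeVar-∷ x (dom X)) , ∃Y≐∃X) ,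
    ≐⟦⟧⇒⊨ fφ nφ FVφ⊆Y (⟦⟧-≐⟦⟧ φ (x ∷ dom X))
    where
    Y : Team
    Y = ⟦ φ ⟧ (x ∷ dom X)
    FVφ⊆Y : FV φ ⊆ x ∷ dom X
    FVφ⊆Y = ⊆-∷-removeVar FV⊆X
    ∃Y≐∃X : ∀ s → mem (∃ₓ x Y) s ⇔ mem (∃ₓ x X) s
    ∃Y≐∃X s = begin
      mem (∃ₓ x Y) s  ≈⟨ ∃ₓ-bound Y (here refl) ⟩
      s ⊨ᵀ ex x φ     ≈⟨ X≐∃φ s ⟨
      mem X s         ≈⟨ ∃ₓ-fresh X x∉X ⟨
      mem (∃ₓ x X) s  ∎
  ≐⟦⟧⇒⊨ {all x φ} {X} (all fφ) (x∉X , nφ) FV⊆X X≐∀φ =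
    Y , ⟦⟧-isTeam φ FVφ⊆Y , here refl , (≐ᵈ-reflexive (removeVar-∷ x (dom X)) , ∀Y≐∃X) ,
    ≐⟦⟧⇒⊨ fφ nφ FVφ⊆Y (⟦⟧-≐⟦⟧ φ (x ∷ dom X))
    where
    Y : Team
    Y = ⟦ φ ⟧ (x ∷ dom X)
    FVφ⊆Y : FV φ ⊆ x ∷ dom X
    FVφ⊆Y = ⊆-∷-removeVar FV⊆X
    ∀Y≐∃X : ∀ s → mem (∀ₓ x Y) s ⇔ mem (∃ₓ x X) s
    ∀Y≐∃X s = begin
      mem (∀ₓ x Y) s  ≈⟨ ∀ₓ-bound Y (here refl) ⟩
      s ⊨ᵀ all x φ    ≈⟨ X≐∀φ s ⟨
      mem X s         ≈⟨ ∃ₓ-fresh X x∉X ⟨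
      mem (∃ₓ x X) s  ∎
  ≐⟦⟧⇒⊨ {gq xs u φ} {X} (gq fφ) (xs#X , nφ) FV⊆X X≐Qφ =
    Y , ⟦⟧-isTeam φ FVφ⊆Y , (λ y → ∈-++⁺ˡ) , ≐⟦⟧⇒⊨ fφ nφ FVφ⊆Y (⟦⟧-≐⟦⟧ φ (toList xs ++ dom X)) ,
    (subst (dom (∃ᵥ xs X) ≐ᵈ_) (sym (removeVars-++ (toList xs) (dom X))) (dom-∃ᵥ xs X) ,
     λ s → ⇔-trans (∃ᵥ-fresh xs X xs#X) (X≐Qφ s))
    where
    Y : Team
    Y = ⟦ φ ⟧ (toList xs ++ dom X)
    FVφ⊆Y : FV φ ⊆ toList xs ++ dom X
    FVφ⊆Y = ⊆-++-removeVars FV⊆X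

mainTheorem2 : ∀ {S : Signature} (𝓜 : Structure S) {n} (𝑸 : GenQuantifier n) →
                 let open Semantics 𝓜 𝑸 in
                 (φ : Formula S n) (X : Team) →
                 IsTeam X →
                 IsFOQ φ → Untangled φ →
                 (∀ x → x ∈ FV φ → x ∈ dom X) →
                 (∀ x → x ∈ BV φ → x ∉ dom X) →
                 ((X ⊨ φ) ⇔ (X ≐ (⟦ φ ⟧ dom X)))
mainTheorem2 𝓜 𝑸 φ X _ isFOQ (noRebind , _) FV⊆X BV#X =
  mk⇔ (λ X⊨φ → ≐ᵈ-reflexive 𝓜 𝑸 refl , ⊨⇒≐⟦⟧ 𝓜 𝑸 isFOQ noRebindX X⊨φ)
      (λ (_ , X≐φ) → ≐⟦⟧⇒⊨ 𝓜 𝑸 isFOQ noRebindX (FV⊆X _) X≐φ)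
  where
  open Semantics 𝓜 𝑸 using (dom)
  noRebindX : NoRebind (dom X) φ
  noRebindX = NoRebind-++ φ noRebind BV#X
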